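{- Let $G$ be a finite simple graph of order $n$. If $\chi(G)\ge n/2+1$, then the Edge-compelling chromatic number of $G$ equals $\chi(G)$.
   Context: A proper coloring partitions $V(G)$ into nonempty independent color classes; a rainbow committee (RC) is a set consisting of exactly one vertex of each color. A proper coloring is Edge-compelling if every RC contains at least one pair of adjacent vertices; the Edge-compelling chromatic number is the minimum number of colors in an Edge-compelling proper coloring. $\chi(G)$ is the chromatic number. -}

module Defs where

open import Data.Nat using (ℕ; _≤_)
open import Data.Fin using (Fin)
open import Data.Product using (Σ; ∃; _×_)
open import Relation.Binary.PropositionalEquality using (_≡_; _≢_)
open import Relation.Nullary using (¬_; Dec)

record Graph (n : ℕ) : Set₁ where
  field
    Adj    : Fin n → Fin n → Set
    sym    : ∀ {u v} → Adj u v → Adj v u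
    irrefl : ∀ {v} → ¬ Adj v v
    dec    : ∀ u v → Dec (Adj u v)
open Graph public

record ProperColoring {n : ℕ} (G : Graph n) (k : ℕ) : Set where
  field
    color    : Fin n → Fin k
    proper   : ∀ {u v} → Adj G u v → color u ≢ color v
    nonempty : ∀ (i : Fin k) → ∃ λ v → color v ≡ i
open ProperColoring public

RainbowCommittee : ∀ {n} {G : Graph n} {k} → ProperColoring G k → Set
RainbowCommittee {n} {G} {k} c =
  Σ (Fin k → Fin n) λ r → ∀ i → color c (r i) ≡ i

EdgeCompelling : ∀ {n} {G : Graph n} {k} → ProperColoring G k → Set
EdgeCompelling {n} {G} {k} c =
  ∀ (R : RainbowCommittee c) →
    ∃ λ i → ∃ λ j → Adj G (Σ.proj₁ R i) (Σ.proj₁ R j)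

IsChromaticNumber : ∀ {n} → Graph n → ℕ → Set
IsChromaticNumber G k =
  ProperColoring G k × (∀ m → ProperColoring G m → k ≤ m)

IsEdgeCompellingChromaticNumber : ∀ {n} → Graph n → ℕ → Set
IsEdgeCompellingChromaticNumber G k =
  (Σ (ProperColoring G k) EdgeCompelling) ×
  (∀ m → (c : ProperColoring G m) → EdgeCompelling c → k ≤ m)

{-# OPTIONS --safe #-}
-- Take a χ-colouring and suppose some rainbow committee R is independent.
-- If two colour classes were singletons, their two vertices lie in R and are
-- non-adjacent, so the classes could be merged into a proper (χ-1)-colouring.
-- Hence all classes but at most one have a vertex outside R, giving
-- n ≥ χ + (χ - 1), which contradicts χ ≥ n/2 + 1.
module Submission where

open import Defs hiding (sym)
open import Data.Nat using (ℕ; zero; suc; _+_; _*_; _≤_; _<_)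
open import Data.Nat.Properties using (≤-trans; ≤-reflexive; m≤n+m; +-monoˡ-≤; 1+n≰n; ≤⇒≯)
open import Data.Nat.Tactic.RingSolver using (solve-∀)
open import Data.Fin using (Fin; zero; punchIn; punchOut; splitAt; join; _≟_)
open import Data.Fin.Properties
  using (any?; punchOut-injective; punchOut-cong; punchOut-punchIn; punchInᵢ≢i; punchIn-injective;
         injective⇒≤; join-splitAt)
open import Data.Product using (∃; ∃₂; _×_; _,_; proj₁; proj₂)
open import Data.Sum using (_⊎_; inj₁; inj₂)
open import Data.Empty using (⊥-elim)
open import Function using (_∘_)
open import Function.Definitions using (Injective)
open import Relation.Nullary using (¬_; Dec; yes; no; ¬?)
open import Relation.Nullary.Decidable using (_×-dec_; decidable-stable)
open import Relation.Unary using (Pred; Decidable)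
open import Relation.Binary.PropositionalEquality using (_≡_; _≢_; refl; sym; trans; cong; subst₂)

twoFailures⊎allButOne : ∀ {p ℓ} {P : Pred (Fin (suc p)) ℓ} → Decidable P →
  (∃₂ λ i j → i ≢ j × ¬ P i × ¬ P j) ⊎ (∃ λ s → ∀ t → t ≢ s → P t)
twoFailures⊎allButOne {P = P} P? with any? (¬? ∘ P?)
... | no ¬∃¬P = inj₂ (zero , λ t _ → decidable-stable (P? t) (λ ¬Pt → ¬∃¬P (t , ¬Pt)))
... | yes (s , ¬Ps) with any? (λ j → ¬? (j ≟ s) ×-dec ¬? (P? j))
...   | yes (j , j≢s , ¬Pj) = inj₁ (s , j , (λ s≡j → j≢s (sym s≡j)) , ¬Ps , ¬Pj)
...   | no ¬∃ = inj₂ (s , λ t t≢s → decidable-stable (P? t) (λ ¬Pt → ¬∃ (t , t≢s , ¬Pt)))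

⊎-injective⇒≤ : ∀ {a b n} {f : Fin a ⊎ Fin b → Fin n} → Injective _≡_ _≡_ f → a + b ≤ n
⊎-injective⇒≤ {a} {b} f-inj = injective⇒≤ λ {x} {y} fx≡fy → splitAt-injective x y (f-inj fx≡fy)
  where
  splitAt-injective : ∀ x y → splitAt a x ≡ splitAt a y → x ≡ y
  splitAt-injective x y eq =
    trans (sym (join-splitAt a b x)) (trans (cong (join a b) eq) (join-splitAt a b y))

HasOtherPreimage : ∀ {n k} → (Fin n → Fin k) → (Fin k → Fin n) → Fin k → Set
HasOtherPreimage f r t = ∃ λ w → f w ≡ t × w ≢ r t

hasOtherPreimage? : ∀ {n k} (f : Fin n → Fin k) (r : Fin k → Fin n) → Decidable (HasOtherPreimage f r)
hasOtherPreimage? f r t = any? (λ w → (f w ≟ t) ×-dec ¬? (w ≟ r t))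

onlyPreimage : ∀ {n k} {f : Fin n → Fin k} {r : Fin k → Fin n} {t u} →
  ¬ HasOtherPreimage f r t → f u ≡ t → u ≡ r t
onlyPreimage {r = r} {t} {u} single fu≡t with u ≟ r t
... | yes u≡rt = u≡rt
... | no u≢rt = ⊥-elim (single (u , fu≡t , u≢rt))

module _ {n p} (f : Fin n → Fin (suc p)) (r : Fin (suc p) → Fin n) (section : ∀ t → f (r t) ≡ t)
         (s : Fin (suc p)) (other : ∀ t → t ≢ s → HasOtherPreimage f r t) where

  private
    second : Fin p → Fin n
    second k = proj₁ (other (punchIn s k) (punchInᵢ≢i s k))

    second-≢ : ∀ k → second k ≢ r (punchIn s k)
    second-≢ k = proj₂ (proj₂ (other (punchIn s k) (punchInᵢ≢i s k)))

    g : Fin (suc p) ⊎ Fin p → Fin n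
    g (inj₁ t) = r t
    g (inj₂ k) = second k

    label : Fin (suc p) ⊎ Fin p → Fin (suc p)
    label (inj₁ t) = t
    label (inj₂ k) = punchIn s k

    f∘g≡label : ∀ x → f (g x) ≡ label x
    f∘g≡label (inj₁ t) = section t
    f∘g≡label (inj₂ k) = proj₁ (proj₂ (other (punchIn s k) (punchInᵢ≢i s k)))

    g-injective : Injective _≡_ _≡_ g
    g-injective {x} {y} gx≡gy = cases x y gx≡gy
      (trans (sym (f∘g≡label x)) (trans (cong f gx≡gy) (f∘g≡label y)))
      where
      cases : ∀ x y → g x ≡ g y → label x ≡ label y → x ≡ y
      cases (inj₁ a) (inj₁ b) _ a≡b = cong inj₁ a≡b
      cases (inj₂ a) (inj₂ b) _ eq = cong inj₂ (punchIn-injective s a b eq)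
      cases (inj₁ a) (inj₂ b) ra≡w eq = ⊥-elim (second-≢ b (trans (sym ra≡w) (cong r eq)))
      cases (inj₂ a) (inj₁ b) w≡rb eq = ⊥-elim (second-≢ a (trans w≡rb (cong r (sym eq))))

  otherPreimages⇒1+p+p≤n : suc p + p ≤ n
  otherPreimages⇒1+p+p≤n = ⊎-injective⇒≤ g-injective

module _ {n p} {G : Graph n} (c : ProperColoring G (suc p)) {i j : Fin (suc p)} (i≢j : i ≢ j)
         (no-edge : ∀ {u v} → color c u ≡ i → color c v ≡ j → ¬ Adj G u v) where

  private
    relabel : Fin (suc p) → Fin (suc p)
    relabel k with k ≟ j
    ... | yes _ = i
    ... | no _ = k

    relabel-≢ : ∀ k → j ≢ relabel k
    relabel-≢ k with k ≟ j
    ... | yes _ = i≢j ∘ sym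
    ... | no k≢j = k≢j ∘ sym

    relabel-fix : ∀ {k} → k ≢ j → relabel k ≡ k
    relabel-fix {k} k≢j with k ≟ j
    ... | yes k≡j = ⊥-elim (k≢j k≡j)
    ... | no _ = refl

    relabel-≡ : ∀ {k l} → relabel k ≡ relabel l → k ≡ l ⊎ (k ≡ j × l ≡ i) ⊎ (k ≡ i × l ≡ j)
    relabel-≡ {k} {l} eq with k ≟ j | l ≟ j
    ... | yes k≡j | yes l≡j = inj₁ (trans k≡j (sym l≡j))
    ... | yes k≡j | no _ = inj₂ (inj₁ (k≡j , sym eq))
    ... | no _ | yes l≡j = inj₂ (inj₂ (eq , l≡j))
    ... | no _ | no _ = inj₁ eq

    merged : Fin n → Fin p
    merged v = punchOut (relabel-≢ (color c v))

    merged-proper : ∀ {u v} → Adj G u v → merged u ≢ merged v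
    merged-proper {u} {v} uv eq with relabel-≡ (punchOut-injective (relabel-≢ (color c u)) (relabel-≢ (color c v)) eq)
    ... | inj₁ same = proper c uv same
    ... | inj₂ (inj₁ (u∈j , v∈i)) = no-edge v∈i u∈j (Graph.sym G uv)
    ... | inj₂ (inj₂ (u∈i , v∈j)) = no-edge u∈i v∈j uv

    merged-nonempty : ∀ k → ∃ λ v → merged v ≡ k
    merged-nonempty k with nonempty c (punchIn j k)
    ... | v , v∈t = v , trans (punchOut-cong j (trans (cong relabel v∈t) (relabel-fix (punchInᵢ≢i j k))))
                              (punchOut-punchIn j)

  mergeClasses : ProperColoring G p
  mergeClasses = record { color = merged ; proper = merged-proper ; nonempty = merged-nonempty }

Independent : ∀ {n k} → Graph n → (Fin k → Fin n) → Set
Independent G r = ∀ i j → ¬ Adj G (r i) (r j)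

edge? : ∀ {n k} (G : Graph n) (r : Fin k → Fin n) → Dec (∃₂ λ i j → Adj G (r i) (r j))
edge? G r = any? (λ i → any? (λ j → dec G (r i) (r j)))

independentCommittee⇒1+p+p≤n : ∀ {n p} {G : Graph n} (c : ProperColoring G (suc p)) →
  ¬ ProperColoring G p → (R : RainbowCommittee c) → Independent G (proj₁ R) → suc p + p ≤ n
independentCommittee⇒1+p+p≤n {G = G} c fewer (r , r-rainbow) indep
  with twoFailures⊎allButOne (hasOtherPreimage? (color c) r)
... | inj₂ (s , other) = otherPreimages⇒1+p+p≤n (color c) r r-rainbow s other
... | inj₁ (i , j , i≢j , single-i , single-j) = ⊥-elim (fewer (mergeClasses c i≢j no-edge))
  where
  no-edge : ∀ {u v} → color c u ≡ i → color c v ≡ j → ¬ Adj G u v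
  no-edge u∈i v∈j uv =
    indep i j (subst₂ (Adj G) (onlyPreimage {r = r} single-i u∈i) (onlyPreimage {r = r} single-j v∈j) uv)

1+p+p≤n⇒2[1+p]<n+2 : ∀ {p n} → suc p + p ≤ n → 2 * suc p < n + 2
1+p+p≤n⇒2[1+p]<n+2 {p} le = ≤-trans (≤-reflexive (sym (identity p))) (+-monoˡ-≤ 2 le)
  where
  identity : ∀ p → suc p + p + 2 ≡ suc (2 * suc p)
  identity = solve-∀

mainTheorem11 : ∀ (n : ℕ) (G : Graph n) (χ : ℕ) →
    IsChromaticNumber G χ → n + 2 ≤ 2 * χ →
    IsEdgeCompellingChromaticNumber G χ
mainTheorem11 n G zero _ n+2≤0 with ≤-trans (m≤n+m 2 n) n+2≤0
... | ()
mainTheorem11 n G (suc p) (c , minimal) n+2≤2χ = (c , compelling) , λ m c′ _ → minimal m c′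
  where
  fewer : ¬ ProperColoring G p
  fewer c′ = 1+n≰n (minimal p c′)

  compelling : EdgeCompelling c
  compelling R with edge? G (proj₁ R)
  ... | yes edge = edge
  ... | no ¬edge = ⊥-elim (≤⇒≯ n+2≤2χ (1+p+p≤n⇒2[1+p]<n+2
          (independentCommittee⇒1+p+p≤n c fewer R (λ i j ij → ¬edge (i , j , ij)))))
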